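{- For all integers $n \geq r \geq 0$, the numbers of $r$-derangements satisfy \[ \sum_{k=0}^{n}\binom{n}{k}\,D_r(k) = n!\,\binom{n}{r}. \]
   Context: For integers $r\geq 0$ and $n\geq 0$, $D_r(n)$ denotes the number of $r$-derangements: fixed-point-free permutations of an $(n+r)$-element set $\{1,\dots,n+r\}$ in which the $r$ elements $1,\dots,r$ lie in distinct cycles of the cycle decomposition. Equivalently, for $n\geq r$, $D_r(n)=\sum_{j=r}^{n}(-1)^{n-j}\binom{j}{r}\frac{n!}{(n-j)!}$, and the exponential generating function is $\sum_{n\geq 0} D_r(n)\frac{x^n}{n!} = \frac{x^r e^{ -x}}{(1-x)^{r+1}}$ (so in particular $D_r(n)=0$ for $n<r$). -}

module Defs where

open import Data.Nat using (ℕ; zero; suc; _∸_; _<ᵇ_)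
open import Data.Nat.Combinatorics using (_C_; _P_)
open import Data.Integer using (ℤ; +_; -_; _*_; _+_)
open import Data.Bool using (if_then_else_)

sumℤ : ℕ → (ℕ → ℤ) → ℤ
sumℤ zero    f = f 0
sumℤ (suc n) f = sumℤ n f + f (suc n)

sumℕ : ℕ → (ℕ → ℕ) → ℕ
sumℕ zero    f = f 0
sumℕ (suc n) f = Data.Nat._+_ (sumℕ n f) (f (suc n))

sign : ℕ → ℤ
sign zero    = + 1
sign (suc m) = - sign m

-- Number of r-derangements D_r(n):
--   D_r(n) = 0 for n < r, and for n ≥ r
--   D_r(n) = Σ_{j=r}^{n} (-1)^{n-j} C(j,r) n!/(n-j)!
-- (n!/(n-j)! is the falling factorial n P j; the sum runs over j = r + i, i = 0..n-r).
D : ℕ → ℕ → ℤ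
D r n = if n <ᵇ r then + 0
        else sumℤ (n ∸ r) (λ i → sign (n ∸ (Data.Nat._+_ r i))
                                   * (+ ((Data.Nat._+_ r i) C r) * + (n P (Data.Nat._+_ r i))))

-- D_r is the inverse binomial transform of j ↦ j! C(j,r): the j-th term of its defining sum is
-- (-1)^(k-j) C(j,r) k!/(k-j)! = (-1)^(k-j) C(k,j) · j! C(j,r), and the terms with j < r vanish.
-- Binomial inversion then gives Σ_k C(n,k) D_r(k) = n! C(n,r).  Inversion itself goes by induction
-- on n: Pascal's rule turns both transforms into first-difference recurrences.
module Submission where

open import Defs
open import Data.Nat using (ℕ; _≤_; _!)
open import Data.Nat.Combinatorics using (_C_)
open import Data.Integer using (ℤ; +_; _*_)
open import Relation.Binary.PropositionalEquality using (_≡_)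

import Algebra.Properties.CommutativeSemigroup as CommutativeSemigroupProperties
open import Data.Bool using (true; false)
open import Data.Integer using (-_; _+_; _-_)
import Data.Integer.Properties as ℤₚ
open import Data.Integer.Tactic.RingSolver using (solve-∀)
open import Data.Nat using (zero; suc; _∸_; _<_; _<ᵇ_; _≤ᵇ_; _≤?_; z≤n; s≤s)
  renaming (_+_ to _+ℕ_; _*_ to _*ℕ_)
open import Data.Nat.Combinatorics using (_P_; nCk≡nPk/k!; nCk+nC[k+1]≡[n+1]C[k+1])
open import Data.Nat.Combinatorics.Specification using (k!∣nP′k; k>n⇒nCk≡0; k>n⇒nPk≡0)
open import Data.Nat.Divisibility using (_∣_)
open import Data.Nat.DivMod using (m/n*n≡m)
import Data.Nat.Properties as ℕₚ
open import Function using (_∘_)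
open import Relation.Nullary using (yes; no)
open import Relation.Nullary.Reflects using (ofʸ; ofⁿ)
open import Relation.Binary.PropositionalEquality
  using (refl; sym; trans; cong; cong₂; _≗_; module ≡-Reasoning)
open ≡-Reasoning

open CommutativeSemigroupProperties ℤₚ.+-commutativeSemigroup using (interchange; x∙yz≈y∙xz)

sumℤ-cong : ∀ n {f g : ℕ → ℤ} → f ≗ g → sumℤ n f ≡ sumℤ n g
sumℤ-cong zero    f≗g = f≗g 0
sumℤ-cong (suc n) f≗g = cong₂ _+_ (sumℤ-cong n f≗g) (f≗g (suc n))

sumℤ-zero : ∀ n {f : ℕ → ℤ} → (∀ i → i ≤ n → f i ≡ + 0) → sumℤ n f ≡ + 0
sumℤ-zero zero    f≡0 = f≡0 0 z≤n
sumℤ-zero (suc n) f≡0 =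
  cong₂ _+_ (sumℤ-zero n (λ i i≤n → f≡0 i (ℕₚ.m≤n⇒m≤1+n i≤n))) (f≡0 (suc n) ℕₚ.≤-refl)

sumℤ-+ : ∀ n (f g : ℕ → ℤ) → sumℤ n (λ i → f i + g i) ≡ sumℤ n f + sumℤ n g
sumℤ-+ zero    f g = refl
sumℤ-+ (suc n) f g =
  trans (cong (_+ (f (suc n) + g (suc n))) (sumℤ-+ n f g))
        (interchange (sumℤ n f) (sumℤ n g) (f (suc n)) (g (suc n)))

sumℤ-neg : ∀ n (f : ℕ → ℤ) → sumℤ n (λ i → - f i) ≡ - sumℤ n f
sumℤ-neg zero    f = refl
sumℤ-neg (suc n) f =
  trans (cong (_+ - f (suc n)) (sumℤ-neg n f)) (sym (ℤₚ.neg-distrib-+ (sumℤ n f) (f (suc n))))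

sumℤ-suc : ∀ n (f : ℕ → ℤ) → sumℤ (suc n) f ≡ f 0 + sumℤ n (f ∘ suc)
sumℤ-suc zero    f = refl
sumℤ-suc (suc n) f =
  trans (cong (_+ f (suc (suc n))) (sumℤ-suc n f)) (ℤₚ.+-assoc (f 0) _ _)

sumℤ-shift : ∀ n (f : ℕ → ℤ) → f (suc n) ≡ + 0 → f 0 + sumℤ n (f ∘ suc) ≡ sumℤ n f
sumℤ-shift n f fₙ₊₁≡0 = begin
  f 0 + sumℤ n (f ∘ suc) ≡⟨ sumℤ-suc n f ⟨
  sumℤ n f + f (suc n)   ≡⟨ cong (_+_ (sumℤ n f)) fₙ₊₁≡0 ⟩
  sumℤ n f + + 0         ≡⟨ ℤₚ.+-identityʳ _ ⟩
  sumℤ n f               ∎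

sumℤ-dropZeros : ∀ r m (f : ℕ → ℤ) → (∀ i → i < r → f i ≡ + 0) →
                 sumℤ (r +ℕ m) f ≡ sumℤ m (λ i → f (r +ℕ i))
sumℤ-dropZeros zero    m f _   = refl
sumℤ-dropZeros (suc r) m f f≡0 = begin
  sumℤ (suc (r +ℕ m)) f                 ≡⟨ sumℤ-suc (r +ℕ m) f ⟩
  f 0 + sumℤ (r +ℕ m) (f ∘ suc)         ≡⟨ cong₂ _+_ (f≡0 0 (s≤s z≤n)) tail ⟩
  + 0 + sumℤ m (λ i → f (suc (r +ℕ i))) ≡⟨ ℤₚ.+-identityˡ _ ⟩
  sumℤ m (λ i → f (suc (r +ℕ i)))       ∎
  where tail = sumℤ-dropZeros r m (f ∘ suc) (λ i i<r → f≡0 (suc i) (s≤s i<r))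

nC[1+n]≡0 : ∀ n → n C suc n ≡ 0
nC[1+n]≡0 n = k>n⇒nCk≡0 {n} {suc n} ℕₚ.≤-refl

k!∣nPk : ∀ {n k} → k ≤ n → k ! ∣ n P k
k!∣nPk {n} {k} k≤n with k ≤ᵇ n | ℕₚ.≤⇒≤ᵇ k≤n
... | true | _ = k!∣nP′k k≤n

nCk*k!≡nPk : ∀ n k → (n C k) *ℕ k ! ≡ n P k
nCk*k!≡nPk n k with k ≤? n
... | yes k≤n = trans (cong (_*ℕ k !) (nCk≡nPk/k! k≤n)) (m/n*n≡m {{ℕₚ._!≢0 k}} (k!∣nPk k≤n))
... | no  k≰n = trans (cong (_*ℕ k !) (k>n⇒nCk≡0 n<k)) (sym (k>n⇒nPk≡0 n<k))
  where n<k = ℕₚ.≰⇒> k≰n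

pascal-* : ∀ n k x → + (suc n C suc k) * x ≡ + (n C k) * x + + (n C suc k) * x
pascal-* n k x = begin
  + (suc n C suc k) * x             ≡⟨ cong (λ c → + c * x) (nCk+nC[k+1]≡[n+1]C[k+1] n k) ⟨
  + (n C k +ℕ n C suc k) * x        ≡⟨ cong (_* x) (ℤₚ.pos-+ (n C k) (n C suc k)) ⟩
  (+ (n C k) + + (n C suc k)) * x   ≡⟨ ℤₚ.*-distribʳ-+ x (+ (n C k)) (+ (n C suc k)) ⟩
  + (n C k) * x + + (n C suc k) * x ∎

sign-∸-suc : ∀ {k j} → j < k → sign (k ∸ j) ≡ - sign (k ∸ suc j)
sign-∸-suc j<k = cong sign (ℕₚ.+-∸-assoc 1 j<k)

-- For j ≥ k the sign identity fails, but then the binomial factor C(k, j+1) is zero.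
sign-flip : ∀ k j x → sign (k ∸ j) * (+ (k C suc j) * x) ≡ - (sign (k ∸ suc j) * (+ (k C suc j) * x))
sign-flip k j x with suc j ≤? k
... | yes j<k = trans (cong (_* (+ (k C suc j) * x)) (sign-∸-suc j<k))
                    (sym (ℤₚ.neg-distribˡ-* (sign (k ∸ suc j)) (+ (k C suc j) * x)))
... | no  j≮k rewrite k>n⇒nCk≡0 {k} {suc j} (ℕₚ.≰⇒> j≮k) =
  trans (ℤₚ.*-zeroʳ (sign (k ∸ j))) (cong -_ (sym (ℤₚ.*-zeroʳ (sign (k ∸ suc j)))))

binomialTransform : (ℕ → ℤ) → ℕ → ℤ
binomialTransform g n = sumℤ n (λ k → + (n C k) * g k)

inverseBinomialTransform : (ℕ → ℤ) → ℕ → ℤ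
inverseBinomialTransform f k = sumℤ k (λ j → sign (k ∸ j) * (+ (k C j) * f j))

binomialTransform-suc : ∀ g n →
  binomialTransform g (suc n) ≡ binomialTransform (g ∘ suc) n + binomialTransform g n
binomialTransform-suc g n = begin
  T g (suc n)                                          ≡⟨ sumℤ-suc n _ ⟩
  c 0 + sumℤ n (λ k → + (suc n C suc k) * g (suc k))   ≡⟨ cong (_+_ (c 0)) (sumℤ-cong n λ k →
                                                            pascal-* n k (g (suc k))) ⟩
  c 0 + sumℤ n (λ k → + (n C k) * g (suc k) + c (suc k)) ≡⟨ cong (_+_ (c 0)) (sumℤ-+ n _ (c ∘ suc)) ⟩
  c 0 + (T (g ∘ suc) n + sumℤ n (c ∘ suc))             ≡⟨ x∙yz≈y∙xz (c 0) (T (g ∘ suc) n) _ ⟩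
  T (g ∘ suc) n + (c 0 + sumℤ n (c ∘ suc))             ≡⟨ cong (_+_ (T (g ∘ suc) n)) (sumℤ-shift n c cₙ₊₁≡0) ⟩
  T (g ∘ suc) n + T g n                                ∎
  where
  T = binomialTransform
  c : ℕ → ℤ
  c k = + (n C k) * g k
  cₙ₊₁≡0 : c (suc n) ≡ + 0
  cₙ₊₁≡0 = cong (λ b → + b * g (suc n)) (nC[1+n]≡0 n)

inverseBinomialTransform-suc : ∀ f k →
  inverseBinomialTransform f (suc k) ≡ inverseBinomialTransform (f ∘ suc) k - inverseBinomialTransform f k
inverseBinomialTransform-suc f k = begin
  S f (suc k)                                     ≡⟨ sumℤ-suc k _ ⟩
  h₀ + sumℤ k (λ j → sign (k ∸ j) * (+ (suc k C suc j) * f (suc j)))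
                                                  ≡⟨ cong (_+_ h₀) (sumℤ-cong k signedPascal) ⟩
  h₀ + sumℤ k (λ j → sign (k ∸ j) * (+ (k C j) * f (suc j)) + v j)
                                                  ≡⟨ cong (_+_ h₀) (sumℤ-+ k _ v) ⟩
  h₀ + (S (f ∘ suc) k + sumℤ k v)                 ≡⟨ x∙yz≈y∙xz h₀ (S (f ∘ suc) k) (sumℤ k v) ⟩
  S (f ∘ suc) k + (h₀ + sumℤ k v)                 ≡⟨ cong (_+_ (S (f ∘ suc) k)) (cong₂ _+_
                                                       (sym (ℤₚ.neg-distribˡ-* (sign k) (+ 1 * f 0)))
                                                       (sumℤ-cong k λ j → sign-flip k j (f (suc j)))) ⟩
  S (f ∘ suc) k + (u 0 + sumℤ k (u ∘ suc))        ≡⟨ cong (_+_ (S (f ∘ suc) k)) (sumℤ-shift k u uₖ₊₁≡0) ⟩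
  S (f ∘ suc) k + sumℤ k u                        ≡⟨ cong (_+_ (S (f ∘ suc) k)) (sumℤ-neg k _) ⟩
  S (f ∘ suc) k - S f k                           ∎
  where
  S = inverseBinomialTransform
  h₀ = sign (suc k) * (+ 1 * f 0)
  v : ℕ → ℤ
  v j = sign (k ∸ j) * (+ (k C suc j) * f (suc j))
  u : ℕ → ℤ
  u j = - (sign (k ∸ j) * (+ (k C j) * f j))
  signedPascal : ∀ j → sign (k ∸ j) * (+ (suc k C suc j) * f (suc j))
                     ≡ sign (k ∸ j) * (+ (k C j) * f (suc j)) + v j
  signedPascal j = trans (cong (sign (k ∸ j) *_) (pascal-* k j (f (suc j))))
                         (ℤₚ.*-distribˡ-+ (sign (k ∸ j)) (+ (k C j) * f (suc j)) (+ (k C suc j) * f (suc j)))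
  uₖ₊₁≡0 : u (suc k) ≡ + 0
  uₖ₊₁≡0 rewrite nC[1+n]≡0 k = cong -_ (ℤₚ.*-zeroʳ (sign (k ∸ suc k)))

binomialTransform-- : ∀ g h n →
  binomialTransform (λ k → g k - h k) n ≡ binomialTransform g n - binomialTransform h n
binomialTransform-- g h n = begin
  binomialTransform (λ k → g k - h k) n
    ≡⟨ sumℤ-cong n (λ k → *-distribˡ-- (+ (n C k)) (g k) (h k)) ⟩
  sumℤ n (λ k → + (n C k) * g k - + (n C k) * h k)
    ≡⟨ sumℤ-+ n _ _ ⟩
  binomialTransform g n + sumℤ n (λ k → - (+ (n C k) * h k))
    ≡⟨ cong (_+_ (binomialTransform g n)) (sumℤ-neg n _) ⟩
  binomialTransform g n - binomialTransform h n
    ∎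
  where
  *-distribˡ-- : ∀ c x y → c * (x - y) ≡ c * x - c * y
  *-distribˡ-- = solve-∀

binomialInversion : ∀ n (f : ℕ → ℤ) → binomialTransform (inverseBinomialTransform f) n ≡ f n
binomialInversion zero    f = trans (ℤₚ.*-identityˡ _) (trans (ℤₚ.*-identityˡ _) (ℤₚ.*-identityˡ (f 0)))
binomialInversion (suc n) f = begin
  T (S f) (suc n)                        ≡⟨ binomialTransform-suc (S f) n ⟩
  T (S f ∘ suc) n + T (S f) n            ≡⟨ cong (_+ T (S f) n) (sumℤ-cong n λ k →
                                              cong (+ (n C k) *_) (inverseBinomialTransform-suc f k)) ⟩
  T (λ k → S (f ∘ suc) k - S f k) n + T (S f) n
                                         ≡⟨ cong (_+ T (S f) n) (binomialTransform-- (S (f ∘ suc)) (S f) n) ⟩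
  T (S (f ∘ suc)) n - T (S f) n + T (S f) n ≡⟨ subtract-add _ _ ⟩
  T (S (f ∘ suc)) n                      ≡⟨ binomialInversion n (f ∘ suc) ⟩
  f (suc n)                              ∎
  where
  T = binomialTransform
  S = inverseBinomialTransform
  subtract-add : ∀ x y → x - y + y ≡ x
  subtract-add = solve-∀

factorialChoose : ℕ → ℕ → ℤ
factorialChoose r j = + (j ! *ℕ (j C r))

factorialChoose-below : ∀ {r j} → j < r → factorialChoose r j ≡ + 0
factorialChoose-below {r} {j} j<r = cong +_ (trans (cong (j ! *ℕ_) (k>n⇒nCk≡0 j<r)) (ℕₚ.*-zeroʳ (j !)))

choose-factorialChoose : ∀ k j r → + (k C j) * factorialChoose r j ≡ + (j C r) * + (k P j)
choose-factorialChoose k j r = begin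
  + (k C j) * + (j ! *ℕ (j C r))  ≡⟨ ℤₚ.pos-* (k C j) _ ⟨
  + ((k C j) *ℕ (j ! *ℕ (j C r)))  ≡⟨ cong +_ (ℕₚ.*-assoc (k C j) (j !) _) ⟨
  + ((k C j) *ℕ j ! *ℕ (j C r))    ≡⟨ cong (λ p → + (p *ℕ (j C r))) (nCk*k!≡nPk k j) ⟩
  + ((k P j) *ℕ (j C r))           ≡⟨ cong +_ (ℕₚ.*-comm (k P j) _) ⟩
  + ((j C r) *ℕ (k P j))           ≡⟨ ℤₚ.pos-* (j C r) _ ⟩
  + (j C r) * + (k P j)            ∎

lowTermVanishes : ∀ k {r j} → j < r → sign (k ∸ j) * (+ (k C j) * factorialChoose r j) ≡ + 0
lowTermVanishes k {r} {j} j<r = begin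
  sign (k ∸ j) * (+ (k C j) * factorialChoose r j) ≡⟨ cong (λ a → sign (k ∸ j) * (+ (k C j) * a))
                                                          (factorialChoose-below j<r) ⟩
  sign (k ∸ j) * (+ (k C j) * + 0)                 ≡⟨ cong (sign (k ∸ j) *_) (ℤₚ.*-zeroʳ (+ (k C j))) ⟩
  sign (k ∸ j) * + 0                               ≡⟨ ℤₚ.*-zeroʳ (sign (k ∸ j)) ⟩
  + 0                                              ∎

D≡inverseBinomialTransform : ∀ r k → D r k ≡ inverseBinomialTransform (factorialChoose r) k
D≡inverseBinomialTransform r k with k <ᵇ r | ℕₚ.<ᵇ-reflects-< k r
... | true  | ofʸ k<r = sym (sumℤ-zero k (λ j j≤k → lowTermVanishes k (ℕₚ.≤-<-trans j≤k k<r)))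
... | false | ofⁿ k≮r = sym (begin
  sumℤ k term                           ≡⟨ cong (λ m → sumℤ m term) (ℕₚ.m+[n∸m]≡n (ℕₚ.≮⇒≥ k≮r)) ⟨
  sumℤ (r +ℕ (k ∸ r)) term              ≡⟨ sumℤ-dropZeros r (k ∸ r) term (λ _ → lowTermVanishes k) ⟩
  sumℤ (k ∸ r) (λ i → term (r +ℕ i))    ≡⟨ sumℤ-cong (k ∸ r) (λ i →
                                             cong (sign (k ∸ (r +ℕ i)) *_) (choose-factorialChoose k (r +ℕ i) r)) ⟩
  sumℤ (k ∸ r) (λ i → sign (k ∸ (r +ℕ i)) * (+ ((r +ℕ i) C r) * + (k P (r +ℕ i)))) ∎)
  where
  term : ℕ → ℤ
  term j = sign (k ∸ j) * (+ (k C j) * factorialChoose r j)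

mainTheorem1 : (n r : ℕ) → r ≤ n →
    sumℤ n (λ k → + (n C k) * D r k) ≡ + ((n !) Data.Nat.* (n C r))
mainTheorem1 n r _ = begin
  sumℤ n (λ k → + (n C k) * D r k)
    ≡⟨ sumℤ-cong n (λ k → cong (+ (n C k) *_) (D≡inverseBinomialTransform r k)) ⟩
  binomialTransform (inverseBinomialTransform (factorialChoose r)) n
    ≡⟨ binomialInversion n (factorialChoose r) ⟩
  factorialChoose r n
    ∎
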